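{- For every graph $G$ with clique number $\omega(G)$ and all integers $k,r>0$, \[ \frac{\omega(G)-1}{\omega(G)}\, w_{2^k r}(G)\ \le\ \Big(\frac{\omega(G)-1}{\omega(G)}\, w_r(G)\Big)^{2^k}. \]
   Context: All graphs are finite and simple. A $k$-walk is a sequence of vertices $v_1,\dots,v_k$ with $v_i$ adjacent to $v_{i+1}$ for $i=1,\dots,k-1$; $w_k(G)$ denotes the number of $k$-walks in $G$. $\omega(G)$ is the clique number. -}

module Defs where

open import Data.Nat using (ℕ; zero; suc; _+_; _*_; _<_)
open import Data.Fin using (Fin)
open import Data.Bool using (Bool; true; false; T)
open import Data.List using (List; length)
open import Data.List.Relation.Unary.Unique.Propositional using (Unique)
open import Data.List.Relation.Unary.AllPairs using (AllPairs)
open import Data.Vec.Functional using (foldr)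
open import Relation.Binary.PropositionalEquality using (_≡_)
open import Relation.Nullary using (¬_)
open import Data.Product using (Σ; _×_)

record Graph (n : ℕ) : Set where
  field
    adj   : Fin n → Fin n → Bool
    sym   : ∀ u v → adj u v ≡ adj v u
    irref : ∀ v → adj v v ≡ false
open Graph public

sumFin : ∀ {n} → (Fin n → ℕ) → ℕ
sumFin f = foldr _+_ 0 f

b2n : Bool → ℕ
b2n true  = 1
b2n false = 0

-- walksFrom G k v = number of walks v = v_1, v_2, …, v_{k+1}
-- (sequences of k+1 vertices starting at v, consecutive ones adjacent)
walksFrom : ∀ {n} → Graph n → ℕ → Fin n → ℕ
walksFrom G zero    v = 1
walksFrom G (suc k) v = sumFin (λ u → b2n (adj G v u) * walksFrom G k u)

-- w k G = number of k-walks (sequences v_1,…,v_k with v_i ~ v_{i+1});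
-- w 0 = 1 counts the empty sequence (never used in the theorem).
w : ∀ {n} → ℕ → Graph n → ℕ
w zero    G = 1
w (suc k) G = sumFin (walksFrom G k)

IsClique : ∀ {n} → Graph n → List (Fin n) → Set
IsClique G vs = Unique vs × AllPairs (λ u v → T (adj G u v)) vs

IsCliqueNumber : ∀ {n} → Graph n → ℕ → Set
IsCliqueNumber G ω =
  Σ (List _) (λ vs → IsClique G vs × length vs ≡ ω)
  × (∀ vs → IsClique G vs → ¬ (ω < length vs))

open import Data.Rational using (ℚ; 1ℚ) renaming (_*_ to _*ℚ_)

_^ℚ_ : ℚ → ℕ → ℚ
x ^ℚ zero  = 1ℚ
x ^ℚ suc e = x *ℚ (x ^ℚ e)

module Submission where

-- Let x be the vector of walk counts x v = walksFrom G (s - 1) v. Then w (2s) = xᵀAx and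
-- w s = Σ x, so the case k = 1 of the theorem is the Motzkin–Straus inequality
-- ω · xᵀAx ≤ (ω - 1) (Σ x)² for a nonnegative integer vector x, and squaring it k times gives
-- the general case. Motzkin–Straus is proved by induction on the size of the support of x.
-- If the support is a clique, it has at most ω vertices, xᵀAx = (Σ x)² - Σ x², and
-- Cauchy–Schwarz gives (Σ x)² ≤ ω Σ x². Otherwise the support contains non-adjacent u, v;
-- then xᵀAx is affine in the amounts placed on u and v, so moving all their mass onto u, or
-- all of it onto v, gives two vectors with the same sum and smaller support of which x is a
-- weighted average.

module Vectors where
  open import Data.Nat using (ℕ; zero; suc; _+_; _*_; _∸_; _≤_; _<_; z≤n; >-nonZero)
  open import Data.Nat.Properties hiding (_≟_)
  open import Data.Nat.Tactic.RingSolver using (solve-∀)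
  open import Data.Fin using (Fin; zero; suc)
  open import Data.Fin.Properties using (_≟_)
  open import Data.Empty using (⊥-elim)
  open import Data.Sum using (inj₁; inj₂)
  open import Function using (_∘_)
  open import Relation.Binary.PropositionalEquality
  open import Relation.Nullary using (yes; no)
  open import Algebra.Properties.Semiring.Sum +-*-semiring
    using (∑-distrib-+; ∑-comm; sum-cong-≗; sum-replicate-zero; *-distribˡ-sum; *-distribʳ-sum)
  open import Defs using (sumFin)

  private variable n : ℕ

  infixl 6 _⊕_

  _⊕_ : (Fin n → ℕ) → (Fin n → ℕ) → Fin n → ℕ
  (x ⊕ y) i = x i + y i

  [_↦_] : Fin n → ℕ → Fin n → ℕ
  [ zero  ↦ γ ] zero    = γ
  [ zero  ↦ γ ] (suc i) = 0
  [ suc u ↦ γ ] zero    = 0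
  [ suc u ↦ γ ] (suc i) = [ u ↦ γ ] i

  erase : Fin n → (Fin n → ℕ) → Fin n → ℕ
  erase zero    x zero    = 0
  erase zero    x (suc i) = x (suc i)
  erase (suc u) x zero    = x zero
  erase (suc u) x (suc i) = erase u (x ∘ suc) i

  single-self : ∀ (u : Fin n) γ → [ u ↦ γ ] u ≡ γ
  single-self zero    γ = refl
  single-self (suc u) γ = single-self u γ

  single-≢ : ∀ {u i : Fin n} γ → u ≢ i → [ u ↦ γ ] i ≡ 0
  single-≢ {u = zero}  {zero}  γ u≢i = ⊥-elim (u≢i refl)
  single-≢ {u = zero}  {suc i} γ u≢i = refl
  single-≢ {u = suc u} {zero}  γ u≢i = refl
  single-≢ {u = suc u} {suc i} γ u≢i = single-≢ γ (u≢i ∘ cong suc)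

  erase-self : ∀ (u : Fin n) x → erase u x u ≡ 0
  erase-self zero    x = refl
  erase-self (suc u) x = erase-self u (x ∘ suc)

  erase-⊕-single : ∀ (u : Fin n) x i → x i ≡ (erase u x ⊕ [ u ↦ x u ]) i
  erase-⊕-single zero    x zero    = refl
  erase-⊕-single zero    x (suc i) = sym (+-identityʳ _)
  erase-⊕-single (suc u) x zero    = sym (+-identityʳ _)
  erase-⊕-single (suc u) x (suc i) = erase-⊕-single u (x ∘ suc) i

  erase-≢ : ∀ {u i : Fin n} x → u ≢ i → erase u x i ≡ x i
  erase-≢ {u = u} {i} x u≢i = sym (begin
    x i                            ≡⟨ erase-⊕-single u x i ⟩
    erase u x i + [ u ↦ x u ] i    ≡⟨ cong (erase u x i +_) (single-≢ (x u) u≢i) ⟩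
    erase u x i + 0                ≡⟨ +-identityʳ _ ⟩
    erase u x i                    ∎)
    where open ≡-Reasoning

  sum-single : ∀ (u : Fin n) γ → sumFin [ u ↦ γ ] ≡ γ
  sum-single {suc n} zero    γ = trans (cong (γ +_) (sum-replicate-zero n)) (+-identityʳ γ)
  sum-single {suc n} (suc u) γ = sum-single u γ

  sum-⊕-single : ∀ (x : Fin n → ℕ) u γ → sumFin (x ⊕ [ u ↦ γ ]) ≡ sumFin x + γ
  sum-⊕-single x u γ = trans (∑-distrib-+ x [ u ↦ γ ]) (cong (sumFin x +_) (sum-single u γ))

  sum-single-* : ∀ (u : Fin n) γ (f : Fin n → ℕ) → sumFin (λ i → [ u ↦ γ ] i * f i) ≡ γ * f u
  sum-single-* {suc n} zero    γ f = trans (cong (γ * f zero +_) (sum-replicate-zero n)) (+-identityʳ _)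
  sum-single-* {suc n} (suc u) γ f = sum-single-* u γ (f ∘ suc)

  sum-mono : ∀ {f g : Fin n → ℕ} → (∀ i → f i ≤ g i) → sumFin f ≤ sumFin g
  sum-mono {zero}  f≤g = z≤n
  sum-mono {suc n} f≤g = +-mono-≤ (f≤g zero) (sum-mono (f≤g ∘ suc))

  sum-*-sum : ∀ (f g : Fin n → ℕ) → sumFin f * sumFin g ≡ sumFin (λ i → sumFin (λ j → f i * g j))
  sum-*-sum f g = begin
    sumFin f * sumFin g                         ≡⟨ *-distribʳ-sum (sumFin g) f ⟩
    sumFin (λ i → f i * sumFin g)               ≡⟨ sum-cong-≗ (λ i → *-distribˡ-sum (f i) g) ⟩
    sumFin (λ i → sumFin (λ j → f i * g j))     ∎
    where open ≡-Reasoning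

  sgn : ℕ → ℕ
  sgn zero    = 0
  sgn (suc _) = 1

  supp : (Fin n → ℕ) → ℕ
  supp x = sumFin (sgn ∘ x)

  sgn-pos : ∀ {x} → 0 < x → sgn x ≡ 1
  sgn-pos {suc x} _ = refl

  sgn-+ : ∀ x y → x * y ≡ 0 → sgn (x + y) ≡ sgn x + sgn y
  sgn-+ zero    y       _  = refl
  sgn-+ (suc x) zero    _  = refl
  sgn-+ (suc x) (suc y) ()

  sgn-single : ∀ (u : Fin n) γ i → sgn ([ u ↦ γ ] i) ≡ [ u ↦ sgn γ ] i
  sgn-single zero    γ zero    = refl
  sgn-single zero    γ (suc i) = refl
  sgn-single (suc u) γ zero    = refl
  sgn-single (suc u) γ (suc i) = sgn-single u γ i

  supp-⊕-single : ∀ {u : Fin n} x γ → x u ≡ 0 → supp (x ⊕ [ u ↦ γ ]) ≡ supp x + sgn γ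
  supp-⊕-single {u = u} x γ xu≡0 = begin
    sumFin (λ i → sgn (x i + [ u ↦ γ ] i))             ≡⟨ sum-cong-≗ (λ i → sgn-+ (x i) _ (disjoint i)) ⟩
    sumFin (λ i → sgn (x i) + sgn ([ u ↦ γ ] i))       ≡⟨ ∑-distrib-+ (sgn ∘ x) _ ⟩
    supp x + sumFin (λ i → sgn ([ u ↦ γ ] i))          ≡⟨ cong (supp x +_) (sum-cong-≗ (sgn-single u γ)) ⟩
    supp x + sumFin [ u ↦ sgn γ ]                      ≡⟨ cong (supp x +_) (sum-single u (sgn γ)) ⟩
    supp x + sgn γ                                     ∎
    where
    open ≡-Reasoning
    disjoint : ∀ i → x i * [ u ↦ γ ] i ≡ 0
    disjoint i with u ≟ i
    ... | yes refl = cong (_* _) xu≡0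
    ... | no u≢i   = trans (cong (x i *_) (single-≢ γ u≢i)) (*-zeroʳ (x i))

  am-gm-+ : ∀ x t → 2 * (x * (x + t)) ≤ x * x + (x + t) * (x + t)
  am-gm-+ x t = begin
    2 * (x * (x + t))           ≤⟨ m≤m+n _ (t * t) ⟩
    2 * (x * (x + t)) + t * t   ≡⟨ expand x t ⟩
    x * x + (x + t) * (x + t)   ∎
    where
    open ≤-Reasoning
    expand : ∀ x t → 2 * (x * (x + t)) + t * t ≡ x * x + (x + t) * (x + t)
    expand = solve-∀

  am-gm : ∀ x y → 2 * (x * y) ≤ x * x + y * y
  am-gm x y with ≤-total x y
  ... | inj₁ x≤y = subst (λ z → 2 * (x * z) ≤ x * x + z * z) (m+[n∸m]≡n x≤y) (am-gm-+ x (y ∸ x))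
  ... | inj₂ y≤x = subst (λ z → 2 * (z * y) ≤ z * z + y * y) (m+[n∸m]≡n y≤x)
                     (subst₂ _≤_ (cong (2 *_) (*-comm y _)) (+-comm (y * y) _) (am-gm-+ y (x ∸ y)))

  am-gm-sgn : ∀ x y → 2 * (x * y) ≤ x * x * sgn y + y * y * sgn x
  am-gm-sgn zero    y       = z≤n
  am-gm-sgn (suc x) zero    rewrite *-zeroʳ x = z≤n
  am-gm-sgn x@(suc _) y@(suc _) =
    subst (2 * (x * y) ≤_) (sym (cong₂ _+_ (*-identityʳ (x * x)) (*-identityʳ (y * y)))) (am-gm x y)

  sumSq : (Fin n → ℕ) → ℕ
  sumSq x = sumFin (λ i → x i * x i)

  sum-sum-symmetric : ∀ (f g : Fin n → ℕ) →
    sumFin (λ i → sumFin (λ j → f i * g j + f j * g i)) ≡ sumFin f * sumFin g + sumFin f * sumFin g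
  sum-sum-symmetric f g = begin
    sumFin (λ i → sumFin (λ j → f i * g j + f j * g i))
      ≡⟨ sum-cong-≗ (λ i → ∑-distrib-+ (λ j → f i * g j) (λ j → f j * g i)) ⟩
    sumFin (λ i → sumFin (λ j → f i * g j) + sumFin (λ j → f j * g i))
      ≡⟨ ∑-distrib-+ (λ i → sumFin (λ j → f i * g j)) (λ i → sumFin (λ j → f j * g i)) ⟩
    sumFin (λ i → sumFin (λ j → f i * g j)) + sumFin (λ i → sumFin (λ j → f j * g i))
      ≡⟨ cong (sumFin (λ i → sumFin (λ j → f i * g j)) +_) (∑-comm (λ i j → f j * g i)) ⟩
    sumFin (λ i → sumFin (λ j → f i * g j)) + sumFin (λ j → sumFin (λ i → f j * g i))
      ≡⟨ sym (cong₂ _+_ (sum-*-sum f g) (sum-*-sum f g)) ⟩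
    sumFin f * sumFin g + sumFin f * sumFin g
      ∎
    where open ≡-Reasoning

  cauchy-schwarz-supp : ∀ (x : Fin n → ℕ) → sumFin x * sumFin x ≤ supp x * sumSq x
  cauchy-schwarz-supp x = *-cancelˡ-≤ 2 (begin
    2 * (sumFin x * sumFin x)
      ≡⟨ cong (2 *_) (sum-*-sum x x) ⟩
    2 * sumFin (λ i → sumFin (λ j → x i * x j))
      ≡⟨ *-distribˡ-sum 2 (λ i → sumFin (λ j → x i * x j)) ⟩
    sumFin (λ i → 2 * sumFin (λ j → x i * x j))
      ≡⟨ sum-cong-≗ (λ i → *-distribˡ-sum 2 (λ j → x i * x j)) ⟩
    sumFin (λ i → sumFin (λ j → 2 * (x i * x j)))
      ≤⟨ sum-mono (λ i → sum-mono (λ j → am-gm-sgn (x i) (x j))) ⟩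
    sumFin (λ i → sumFin (λ j → x i * x i * sgn (x j) + x j * x j * sgn (x i)))
      ≡⟨ sum-sum-symmetric (λ i → x i * x i) (sgn ∘ x) ⟩
    sumSq x * supp x + sumSq x * supp x
      ≡⟨ twice (sumSq x) (supp x) ⟩
    2 * (supp x * sumSq x)
      ∎)
    where
    open ≤-Reasoning
    twice : ∀ s t → s * t + s * t ≡ 2 * (t * s)
    twice = solve-∀

  weighted-average-≤ : ∀ {α β q q₁ q₂} k {t} → 0 < α + β → (α + β) * q ≡ α * q₁ + β * q₂ →
    k * q₁ ≤ t → k * q₂ ≤ t → k * q ≤ t
  weighted-average-≤ {α} {β} {q} {q₁} {q₂} k {t} 0<α+β average kq₁≤t kq₂≤t =
    *-cancelˡ-≤ (α + β) {{>-nonZero 0<α+β}} (begin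
      (α + β) * (k * q)              ≡⟨ commute (α + β) k q ⟩
      k * ((α + β) * q)              ≡⟨ cong (k *_) average ⟩
      k * (α * q₁ + β * q₂)          ≡⟨ spread k α β q₁ q₂ ⟩
      α * (k * q₁) + β * (k * q₂)    ≤⟨ +-mono-≤ (*-monoʳ-≤ α kq₁≤t) (*-monoʳ-≤ β kq₂≤t) ⟩
      α * t + β * t                  ≡⟨ *-distribʳ-+ t α β ⟨
      (α + β) * t                    ∎)
    where
    open ≤-Reasoning
    commute : ∀ s k q → s * (k * q) ≡ k * (s * q)
    commute = solve-∀
    spread : ∀ k α β x y → k * (α * x + β * y) ≡ α * (k * x) + β * (k * y)
    spread = solve-∀

  module Replace₂ (a : Fin n → ℕ) {u v : Fin n} (u≢v : u ≢ v) where
    rest : Fin n → ℕ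
    rest = erase u (erase v a)

    replace₂ : ℕ → ℕ → Fin n → ℕ
    replace₂ γ η = rest ⊕ [ u ↦ γ ] ⊕ [ v ↦ η ]

    a≗replace₂ : a ≗ replace₂ (a u) (a v)
    a≗replace₂ i = begin
      a i
        ≡⟨ erase-⊕-single v a i ⟩
      erase v a i + [ v ↦ a v ] i
        ≡⟨ cong (_+ [ v ↦ a v ] i) (erase-⊕-single u (erase v a) i) ⟩
      rest i + [ u ↦ erase v a u ] i + [ v ↦ a v ] i
        ≡⟨ cong (λ γ → rest i + [ u ↦ γ ] i + [ v ↦ a v ] i) (erase-≢ a (u≢v ∘ sym)) ⟩
      rest i + [ u ↦ a u ] i + [ v ↦ a v ] i
        ∎
      where open ≡-Reasoning

    sum-replace₂ : ∀ γ η → sumFin (replace₂ γ η) ≡ sumFin rest + γ + η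
    sum-replace₂ γ η = trans (sum-⊕-single (rest ⊕ [ u ↦ γ ]) v η) (cong (_+ η) (sum-⊕-single rest u γ))

    supp-replace₂ : ∀ γ η → supp (replace₂ γ η) ≡ supp rest + sgn γ + sgn η
    supp-replace₂ γ η = begin
      supp (rest ⊕ [ u ↦ γ ] ⊕ [ v ↦ η ])
        ≡⟨ supp-⊕-single (rest ⊕ [ u ↦ γ ]) η rest⊕γ-at-v≡0 ⟩
      supp (rest ⊕ [ u ↦ γ ]) + sgn η
        ≡⟨ cong (_+ sgn η) (supp-⊕-single rest γ (erase-self u (erase v a))) ⟩
      supp rest + sgn γ + sgn η
        ∎
      where
      open ≡-Reasoning
      rest⊕γ-at-v≡0 : rest v + [ u ↦ γ ] v ≡ 0
      rest⊕γ-at-v≡0 = cong₂ _+_ (trans (erase-≢ (erase v a) u≢v) (erase-self v a)) (single-≢ γ u≢v)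

module Lists where
  open import Data.Nat using (zero; suc)
  open import Data.Fin as Fin using (Fin)
  open import Data.Bool using (true; false)
  open import Data.List using (length; filter; tabulate)
  open import Data.List.Relation.Unary.All as All using (All; []; _∷_)
  open import Data.List.Relation.Unary.AllPairs using (AllPairs; []; _∷_)
  open import Data.Product using (_,_)
  open import Function using (_∘_)
  open import Relation.Binary.PropositionalEquality using (_≡_; refl; cong)
  open import Relation.Nullary using (does)
  open import Relation.Unary using (Decidable)
  open import Defs using (b2n; sumFin)

  length-filter-tabulate : ∀ {A : Set} {P : A → Set} (P? : Decidable P) {k} (f : Fin k → A) →
    length (filter P? (tabulate f)) ≡ sumFin (λ j → b2n (does (P? (f j))))
  length-filter-tabulate P? {zero}  f = refl
  length-filter-tabulate P? {suc k} f with does (P? (f Fin.zero))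
  ... | true  = cong suc (length-filter-tabulate P? (f ∘ Fin.suc))
  ... | false = length-filter-tabulate P? (f ∘ Fin.suc)

  allPairs-discharge : ∀ {A : Set} {P : A → Set} {R : A → A → Set} {xs} →
    All P xs → AllPairs (λ x y → P x → P y → R x y) xs → AllPairs R xs
  allPairs-discharge []         []         = []
  allPairs-discharge (px ∷ pxs) (hx ∷ hxs) =
    All.zipWith (λ (py , h) → h px py) (pxs , hx) ∷ allPairs-discharge pxs hxs

open import Data.Nat using (ℕ)
open import Defs using (Graph)

module Adjacency {n : ℕ} (G : Graph n) where
  open import Data.Nat using (zero; suc; _+_; _*_)
  open import Data.Nat.Properties
  open import Data.Nat.Tactic.RingSolver using (solve-∀)
  open import Data.Fin using (Fin)
  open import Function using (_∘_)
  open import Relation.Binary.PropositionalEquality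
  open import Algebra.Properties.Semiring.Sum +-*-semiring
    using (∑-distrib-+; ∑-comm; sum-cong-≗; *-distribˡ-sum)
  open import Data.Bool using (false)
  open import Defs using (adj; irref; b2n; sumFin; walksFrom; w)
  open Vectors

  A : Fin n → Fin n → ℕ
  A i j = b2n (adj G i j)

  A-sym : ∀ i j → A i j ≡ A j i
  A-sym i j = cong b2n (Graph.sym G i j)

  A-irrefl : ∀ i → A i i ≡ 0
  A-irrefl i = cong b2n (irref G i)

  nbrSum : (Fin n → ℕ) → Fin n → ℕ
  nbrSum x i = sumFin (λ j → A i j * x j)

  form : (Fin n → ℕ) → (Fin n → ℕ) → ℕ
  form x y = sumFin (λ i → x i * nbrSum y i)

  quad : (Fin n → ℕ) → ℕ
  quad x = form x x

  nbrSum-⊕ : ∀ x y i → nbrSum (x ⊕ y) i ≡ nbrSum x i + nbrSum y i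
  nbrSum-⊕ x y i = trans (sum-cong-≗ (λ j → *-distribˡ-+ (A i j) (x j) (y j)))
                         (∑-distrib-+ (λ j → A i j * x j) (λ j → A i j * y j))

  nbrSum-single : ∀ v η i → nbrSum [ v ↦ η ] i ≡ η * A i v
  nbrSum-single v η i = trans (sum-cong-≗ (λ j → *-comm (A i j) _)) (sum-single-* v η (A i))

  form-⊕ˡ : ∀ x y z → form (x ⊕ y) z ≡ form x z + form y z
  form-⊕ˡ x y z = trans (sum-cong-≗ (λ i → *-distribʳ-+ (nbrSum z i) (x i) (y i)))
                        (∑-distrib-+ (λ i → x i * nbrSum z i) (λ i → y i * nbrSum z i))

  form-⊕ʳ : ∀ x y z → form x (y ⊕ z) ≡ form x y + form x z
  form-⊕ʳ x y z = trans (sum-cong-≗ λ i → trans (cong (x i *_) (nbrSum-⊕ y z i)) (*-distribˡ-+ (x i) _ _))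
                        (∑-distrib-+ (λ i → x i * nbrSum y i) (λ i → x i * nbrSum z i))

  form-singleˡ : ∀ u γ y → form [ u ↦ γ ] y ≡ γ * nbrSum y u
  form-singleˡ u γ y = sum-single-* u γ (nbrSum y)

  form-sym : ∀ x y → form x y ≡ form y x
  form-sym x y = begin
    sumFin (λ i → x i * sumFin (λ j → A i j * y j))
      ≡⟨ sum-cong-≗ (λ i → *-distribˡ-sum (x i) (λ j → A i j * y j)) ⟩
    sumFin (λ i → sumFin (λ j → x i * (A i j * y j)))
      ≡⟨ ∑-comm (λ i j → x i * (A i j * y j)) ⟩
    sumFin (λ j → sumFin (λ i → x i * (A i j * y j)))
      ≡⟨ sum-cong-≗ (λ j → sum-cong-≗ (λ i →
           trans (cong (λ c → x i * (c * y j)) (A-sym i j)) (rotate (x i) (A j i) (y j)))) ⟩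
    sumFin (λ j → sumFin (λ i → y j * (A j i * x i)))
      ≡⟨ sum-cong-≗ (λ j → *-distribˡ-sum (y j) (λ i → A j i * x i)) ⟨
    sumFin (λ j → y j * sumFin (λ i → A j i * x i))
      ∎
    where
    open ≡-Reasoning
    rotate : ∀ a c b → a * (c * b) ≡ b * (c * a)
    rotate = solve-∀

  quad-⊕ : ∀ x y → quad (x ⊕ y) ≡ quad x + 2 * form x y + quad y
  quad-⊕ x y = begin
    form (x ⊕ y) (x ⊕ y)
      ≡⟨ form-⊕ˡ x y (x ⊕ y) ⟩
    form x (x ⊕ y) + form y (x ⊕ y)
      ≡⟨ cong₂ _+_ (form-⊕ʳ x x y) (form-⊕ʳ y x y) ⟩
    (quad x + form x y) + (form y x + quad y)
      ≡⟨ cong (λ t → (quad x + form x y) + (t + quad y)) (form-sym y x) ⟩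
    (quad x + form x y) + (form x y + quad y)
      ≡⟨ rearrange (quad x) (form x y) (quad y) ⟩
    quad x + 2 * form x y + quad y
      ∎
    where
    open ≡-Reasoning
    rearrange : ∀ p q r → (p + q) + (q + r) ≡ p + 2 * q + r
    rearrange = solve-∀

  quad-cong : ∀ {x y} → x ≗ y → quad x ≡ quad y
  quad-cong x≗y = sum-cong-≗ (λ i → cong₂ _*_ (x≗y i) (sum-cong-≗ (λ j → cong (A i j *_) (x≗y j))))

  form-singleʳ : ∀ x v η → form x [ v ↦ η ] ≡ η * nbrSum x v
  form-singleʳ x v η = trans (form-sym x [ v ↦ η ]) (form-singleˡ v η x)

  form-single-nonEdge : ∀ {u v} γ η → adj G u v ≡ false → form [ u ↦ γ ] [ v ↦ η ] ≡ 0
  form-single-nonEdge {u} {v} γ η u≁v = begin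
    form [ u ↦ γ ] [ v ↦ η ]      ≡⟨ form-singleˡ u γ [ v ↦ η ] ⟩
    γ * nbrSum [ v ↦ η ] u        ≡⟨ cong (γ *_) (nbrSum-single v η u) ⟩
    γ * (η * A u v)               ≡⟨ cong (λ a → γ * (η * a)) (cong b2n u≁v) ⟩
    γ * (η * 0)                   ≡⟨ cong (γ *_) (*-zeroʳ η) ⟩
    γ * 0                         ≡⟨ *-zeroʳ γ ⟩
    0                             ∎
    where open ≡-Reasoning

  quad-along-nonEdge : ∀ {u v} x γ η → adj G u v ≡ false →
    quad (x ⊕ [ u ↦ γ ] ⊕ [ v ↦ η ]) ≡ quad x + 2 * (γ * nbrSum x u + η * nbrSum x v)
  quad-along-nonEdge {u} {v} x γ η u≁v = begin
    quad (x ⊕ eu ⊕ ev)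
      ≡⟨ quad-⊕ (x ⊕ eu) ev ⟩
    quad (x ⊕ eu) + 2 * form (x ⊕ eu) ev + quad ev
      ≡⟨ cong₂ (λ p q → p + 2 * q + quad ev) (quad-⊕ x eu) (form-⊕ˡ x eu ev) ⟩
    quad x + 2 * form x eu + quad eu + 2 * (form x ev + form eu ev) + quad ev
      ≡⟨ cong₂ (λ p q → quad x + 2 * p + quad eu + 2 * (q + form eu ev) + quad ev)
               (form-singleʳ x u γ) (form-singleʳ x v η) ⟩
    quad x + 2 * (γ * nbrSum x u) + quad eu + 2 * (η * nbrSum x v + form eu ev) + quad ev
      ≡⟨ cong₂ (λ p q → quad x + 2 * (γ * nbrSum x u) + p + 2 * (η * nbrSum x v + q) + quad ev)
               (form-single-nonEdge γ γ (irref G u)) (form-single-nonEdge γ η u≁v) ⟩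
    quad x + 2 * (γ * nbrSum x u) + 0 + 2 * (η * nbrSum x v + 0) + quad ev
      ≡⟨ cong (quad x + 2 * (γ * nbrSum x u) + 0 + 2 * (η * nbrSum x v + 0) +_)
              (form-single-nonEdge η η (irref G v)) ⟩
    quad x + 2 * (γ * nbrSum x u) + 0 + 2 * (η * nbrSum x v + 0) + 0
      ≡⟨ rearrange (quad x) (γ * nbrSum x u) (η * nbrSum x v) ⟩
    quad x + 2 * (γ * nbrSum x u + η * nbrSum x v)
      ∎
    where
    open ≡-Reasoning
    eu ev : Fin n → ℕ
    eu = [ u ↦ γ ]
    ev = [ v ↦ η ]
    rearrange : ∀ q p r → q + 2 * p + 0 + 2 * (r + 0) + 0 ≡ q + 2 * (p + r)
    rearrange = solve-∀

  walks-split : ∀ j k → sumFin (walksFrom G (j + k)) ≡ sumFin (λ u → walksFrom G j u * walksFrom G k u)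
  walks-split zero    k = sum-cong-≗ (λ u → sym (*-identityˡ (walksFrom G k u)))
  walks-split (suc j) k = begin
    sumFin (walksFrom G (suc j + k))
      ≡⟨ cong (sumFin ∘ walksFrom G) (+-suc j k) ⟨
    sumFin (walksFrom G (j + suc k))
      ≡⟨ walks-split j (suc k) ⟩
    form (walksFrom G j) (walksFrom G k)
      ≡⟨ form-sym (walksFrom G j) (walksFrom G k) ⟩
    form (walksFrom G k) (walksFrom G j)
      ≡⟨ sum-cong-≗ (λ u → *-comm (walksFrom G k u) _) ⟩
    sumFin (λ u → walksFrom G (suc j) u * walksFrom G k u)
      ∎
    where open ≡-Reasoning

  walks-double : ∀ t → w (suc t + suc t) G ≡ quad (walksFrom G t)
  walks-double t = walks-split t (suc t)

module MotzkinStraus {n : ℕ} (G : Graph n) where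
  open import Data.Nat using (zero; suc; _+_; _*_; _≤_; _<_; _<?_; z<s)
  open import Data.Nat.Properties hiding (_≟_)
  open import Data.Nat.Induction using (<-wellFounded)
  open import Data.Nat.Tactic.RingSolver using (solve-∀)
  open import Data.Bool using (false; T)
  open import Data.Bool.Properties using (T-≡; ¬-not) renaming (_≟_ to _≟ᵇ_)
  open import Data.Fin using (Fin)
  open import Data.Fin.Properties using (_≟_; any?)
  open import Data.List using (List; length; filter; allFin)
  open import Data.List.Relation.Unary.All.Properties using (all-filter)
  open import Data.List.Relation.Unary.AllPairs using (AllPairs)
  import Data.List.Relation.Unary.AllPairs.Properties as AllPairs
  open import Data.List.Relation.Unary.Unique.Propositional using (Unique)
  import Data.List.Relation.Unary.Unique.Propositional.Properties as Unique
  open import Data.Product using (∃₂; _×_; _,_)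
  open import Data.Sum using (_⊎_; inj₁; inj₂)
  open import Function using (_∘_; Equivalence)
  open import Induction.WellFounded using (Acc; acc)
  open import Relation.Binary.PropositionalEquality
  open import Relation.Nullary using (Dec; yes; no; does; ¬?)
  open import Relation.Nullary.Decidable using (_×-dec_)
  open import Algebra.Properties.Semiring.Sum +-*-semiring
    using (∑-distrib-+; sum-cong-≗; *-distribʳ-sum)
  open import Defs using (adj; b2n; sumFin; walksFrom; w; IsCliqueNumber)
  open Vectors
  open Lists
  open Adjacency G

  SupportNonEdge : (Fin n → ℕ) → Set
  SupportNonEdge a = ∃₂ λ u v → u ≢ v × adj G u v ≡ false × 0 < a u × 0 < a v

  SupportClique : (Fin n → ℕ) → Set
  SupportClique a = ∀ {u v} → u ≢ v → 0 < a u → 0 < a v → T (adj G u v)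

  nonEdge? : ∀ (a : Fin n → ℕ) u v → Dec (u ≢ v × adj G u v ≡ false × 0 < a u × 0 < a v)
  nonEdge? a u v = ¬? (u ≟ v) ×-dec (adj G u v ≟ᵇ false) ×-dec (0 <? a u) ×-dec (0 <? a v)

  nonEdge⊎clique : ∀ a → SupportNonEdge a ⊎ SupportClique a
  nonEdge⊎clique a with any? (λ u → any? (nonEdge? a u))
  ... | yes nonEdge = inj₁ nonEdge
  ... | no ¬nonEdge = inj₂ λ {u} {v} u≢v au av →
    Equivalence.from T-≡ (¬-not λ u≁v → ¬nonEdge (u , v , u≢v , u≁v , au , av))

  support : (Fin n → ℕ) → List (Fin n)
  support a = filter (λ i → 0 <? a i) (allFin n)

  length-support : ∀ a → length (support a) ≡ supp a
  length-support a = trans (length-filter-tabulate (λ i → 0 <? a i) (λ i → i))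
                           (sum-cong-≗ (λ i → indicator (a i)))
    where
    indicator : ∀ x → b2n (does (0 <? x)) ≡ sgn x
    indicator zero    = refl
    indicator (suc x) = refl

  supp≤cliqueNumber : ∀ {ω} a → IsCliqueNumber G ω → SupportClique a → supp a ≤ ω
  supp≤cliqueNumber a (_ , maximal) clique =
    subst (_≤ _) (length-support a) (≮⇒≥ (maximal (support a) (distinct , adjacent)))
    where
    distinct : Unique (support a)
    distinct = Unique.filter⁺ (λ i → 0 <? a i) (Unique.allFin⁺ n)
    adjacent : AllPairs (λ u v → T (adj G u v)) (support a)
    adjacent = allPairs-discharge (all-filter (λ i → 0 <? a i) (allFin n))
                 (AllPairs.filter⁺ (λ i → 0 <? a i) (AllPairs.tabulate⁺ clique))

  nbrSum-clique : ∀ a → SupportClique a → ∀ {i} → 0 < a i → nbrSum a i + a i ≡ sumFin a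
  nbrSum-clique a clique {i} 0<ai = begin
    nbrSum a i + a i
      ≡⟨ cong (nbrSum a i +_) (sum-single i (a i)) ⟨
    nbrSum a i + sumFin [ i ↦ a i ]
      ≡⟨ ∑-distrib-+ (λ j → A i j * a j) [ i ↦ a i ] ⟨
    sumFin (λ j → A i j * a j + [ i ↦ a i ] j)
      ≡⟨ sum-cong-≗ entry ⟩
    sumFin a
      ∎
    where
    open ≡-Reasoning
    entry : ∀ j → A i j * a j + [ i ↦ a i ] j ≡ a j
    entry j with i ≟ j | 0 <? a j
    ... | yes refl | _ rewrite A-irrefl i = single-self i (a i)
    ... | no i≢j | yes 0<aj rewrite single-≢ (a i) i≢j | Equivalence.to T-≡ (clique i≢j 0<ai 0<aj) =
      trans (+-identityʳ _) (*-identityˡ (a j))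
    ... | no i≢j | no 0≮aj rewrite single-≢ (a i) i≢j | n≤0⇒n≡0 (≮⇒≥ 0≮aj) =
      trans (+-identityʳ _) (*-zeroʳ (A i j))

  quad-clique : ∀ a → SupportClique a → quad a + sumSq a ≡ sumFin a * sumFin a
  quad-clique a clique = begin
    quad a + sumSq a
      ≡⟨ ∑-distrib-+ (λ i → a i * nbrSum a i) (λ i → a i * a i) ⟨
    sumFin (λ i → a i * nbrSum a i + a i * a i)
      ≡⟨ sum-cong-≗ (λ i → *-distribˡ-+ (a i) (nbrSum a i) (a i)) ⟨
    sumFin (λ i → a i * (nbrSum a i + a i))
      ≡⟨ sum-cong-≗ row ⟩
    sumFin (λ i → a i * sumFin a)
      ≡⟨ *-distribʳ-sum (sumFin a) a ⟨
    sumFin a * sumFin a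
      ∎
    where
    open ≡-Reasoning
    row : ∀ i → a i * (nbrSum a i + a i) ≡ a i * sumFin a
    row i with 0 <? a i
    ... | yes 0<ai = cong (a i *_) (nbrSum-clique a clique 0<ai)
    ... | no 0≮ai rewrite n≤0⇒n≡0 (≮⇒≥ 0≮ai) = refl

  clique-bound : ∀ {m} a → IsCliqueNumber G (suc m) → SupportClique a →
    suc m * quad a ≤ m * (sumFin a * sumFin a)
  clique-bound {m} a ω clique = +-cancelʳ-≤ S² (suc m * quad a) (m * S²) (begin
    suc m * quad a + S²                ≤⟨ +-monoʳ-≤ (suc m * quad a) S²≤ ⟩
    suc m * quad a + suc m * sumSq a   ≡⟨ *-distribˡ-+ (suc m) (quad a) (sumSq a) ⟨
    suc m * (quad a + sumSq a)         ≡⟨ cong (suc m *_) (quad-clique a clique) ⟩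
    suc m * S²                         ≡⟨ +-comm S² (m * S²) ⟩
    m * S² + S²                        ∎)
    where
    open ≤-Reasoning
    S² : ℕ
    S² = sumFin a * sumFin a
    S²≤ : S² ≤ suc m * sumSq a
    S²≤ = ≤-trans (cauchy-schwarz-supp a) (*-monoˡ-≤ (sumSq a) (supp≤cliqueNumber a ω clique))

  module MassShift {a : Fin n → ℕ} {u v : Fin n} (u≢v : u ≢ v) (u≁v : adj G u v ≡ false)
                   (0<au : 0 < a u) (0<av : 0 < a v) where
    open Replace₂ a u≢v

    toU toV : Fin n → ℕ
    toU = replace₂ (a u + a v) 0
    toV = replace₂ 0 (a u + a v)

    0<au+av : 0 < a u + a v
    0<au+av = ≤-trans 0<au (m≤m+n (a u) (a v))

    quad-toU-toV : (a u + a v) * quad a ≡ a u * quad toU + a v * quad toV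
    quad-toU-toV = begin
      (a u + a v) * quad a
        ≡⟨ cong ((a u + a v) *_) (trans (quad-cong a≗replace₂) (quad-along-nonEdge rest (a u) (a v) u≁v)) ⟩
      (a u + a v) * (quad rest + 2 * (a u * nbrSum rest u + a v * nbrSum rest v))
        ≡⟨ linear (a u) (a v) (quad rest) (nbrSum rest u) (nbrSum rest v) ⟩
      a u * (quad rest + 2 * ((a u + a v) * nbrSum rest u + 0 * nbrSum rest v))
        + a v * (quad rest + 2 * (0 * nbrSum rest u + (a u + a v) * nbrSum rest v))
        ≡⟨ cong₂ (λ p q → a u * p + a v * q) (quad-along-nonEdge rest (a u + a v) 0 u≁v)
                                              (quad-along-nonEdge rest 0 (a u + a v) u≁v) ⟨
      a u * quad toU + a v * quad toV
        ∎
      where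
      open ≡-Reasoning
      linear : ∀ α β Q P R → (α + β) * (Q + 2 * (α * P + β * R))
        ≡ α * (Q + 2 * ((α + β) * P + 0 * R)) + β * (Q + 2 * (0 * P + (α + β) * R))
      linear = solve-∀

    sum-a : sumFin a ≡ sumFin rest + a u + a v
    sum-a = trans (sum-cong-≗ a≗replace₂) (sum-replace₂ (a u) (a v))

    sum-toU : sumFin toU ≡ sumFin a
    sum-toU = trans (sum-replace₂ (a u + a v) 0) (trans (regroup (sumFin rest) (a u) (a v)) (sym sum-a))
      where
      regroup : ∀ s α β → s + (α + β) + 0 ≡ s + α + β
      regroup = solve-∀

    sum-toV : sumFin toV ≡ sumFin a
    sum-toV = trans (sum-replace₂ 0 (a u + a v)) (trans (regroup (sumFin rest) (a u) (a v)) (sym sum-a))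
      where
      regroup : ∀ s α β → s + 0 + (α + β) ≡ s + α + β
      regroup = solve-∀

    supp-a : supp a ≡ supp rest + 1 + 1
    supp-a = begin
      supp a                              ≡⟨ sum-cong-≗ (cong sgn ∘ a≗replace₂) ⟩
      supp (replace₂ (a u) (a v))         ≡⟨ supp-replace₂ (a u) (a v) ⟩
      supp rest + sgn (a u) + sgn (a v)   ≡⟨ cong₂ (λ p q → supp rest + p + q) (sgn-pos 0<au) (sgn-pos 0<av) ⟩
      supp rest + 1 + 1                   ∎
      where open ≡-Reasoning

    supp-toU : supp toU < supp a
    supp-toU = begin-strict
      supp toU                          ≡⟨ supp-replace₂ (a u + a v) 0 ⟩
      supp rest + sgn (a u + a v) + 0   ≡⟨ cong (λ p → supp rest + p + 0) (sgn-pos 0<au+av) ⟩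
      supp rest + 1 + 0                 <⟨ +-monoʳ-< (supp rest + 1) z<s ⟩
      supp rest + 1 + 1                 ≡⟨ supp-a ⟨
      supp a                            ∎
      where open ≤-Reasoning

    supp-toV : supp toV < supp a
    supp-toV = begin-strict
      supp toV                          ≡⟨ supp-replace₂ 0 (a u + a v) ⟩
      supp rest + 0 + sgn (a u + a v)   ≡⟨ cong (supp rest + 0 +_) (sgn-pos 0<au+av) ⟩
      supp rest + 0 + 1                 <⟨ +-monoˡ-< 1 (+-monoʳ-< (supp rest) z<s) ⟩
      supp rest + 1 + 1                 ≡⟨ supp-a ⟨
      supp a                            ∎
      where open ≤-Reasoning

  nonEdge-step : ∀ {k t} a → SupportNonEdge a →
    (∀ b → supp b < supp a → k * quad b ≤ t * (sumFin b * sumFin b)) →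
    k * quad a ≤ t * (sumFin a * sumFin a)
  nonEdge-step {k} {t} a (u , v , u≢v , u≁v , 0<au , 0<av) smaller =
    weighted-average-≤ {a u} {a v} k 0<au+av quad-toU-toV
      (subst (λ s → k * quad toU ≤ t * (s * s)) sum-toU (smaller toU supp-toU))
      (subst (λ s → k * quad toV ≤ t * (s * s)) sum-toV (smaller toV supp-toV))
    where open MassShift u≢v u≁v 0<au 0<av

  motzkin-straus : ∀ {m} → IsCliqueNumber G (suc m) → ∀ a → suc m * quad a ≤ m * (sumFin a * sumFin a)
  motzkin-straus {m} ω a = bound a (<-wellFounded (supp a))
    where
    bound : ∀ a → Acc _<_ (supp a) → suc m * quad a ≤ m * (sumFin a * sumFin a)
    bound a (acc smaller) with nonEdge⊎clique a
    ... | inj₁ nonEdge = nonEdge-step {suc m} {m} a nonEdge (λ b supp-b<supp-a →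
                                                               bound b (smaller supp-b<supp-a))
    ... | inj₂ clique  = clique-bound a ω clique

  walks-doubling-bound : ∀ {m} → IsCliqueNumber G (suc m) →
    ∀ s → 0 < s → suc m * w (s + s) G ≤ m * (w s G * w s G)
  walks-doubling-bound {m} ω (suc t) _ =
    subst (λ q → suc m * q ≤ m * (w (suc t) G * w (suc t) G)) (sym (walks-double t))
          (motzkin-straus ω (walksFrom G t))

module Squaring where
  open import Data.Nat as ℕ using (zero; suc; _^_)
  import Data.Nat.Properties as ℕ
  open import Data.Nat.Tactic.RingSolver using (solve-∀)
  open import Data.Integer as ℤ using (+_; +≤+)
  open import Data.Integer.Properties as ℤ using (pos-*)
  open import Data.Rational using (ℚ; 0ℚ; _/_; _≤_; _*_; nonNegative; toℚᵘ)
  open import Data.Rational.Properties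
  import Data.Rational.Unnormalised as ℚᵘ
  import Data.Rational.Unnormalised.Properties as ℚᵘ
  open import Relation.Binary.PropositionalEquality
  open import Defs using (_^ℚ_)

  ^ℚ-+ : ∀ x a b → x ^ℚ (a ℕ.+ b) ≡ x ^ℚ a * x ^ℚ b
  ^ℚ-+ x zero    b = sym (*-identityˡ (x ^ℚ b))
  ^ℚ-+ x (suc a) b = trans (cong (x *_) (^ℚ-+ x a b)) (sym (*-assoc x (x ^ℚ a) (x ^ℚ b)))

  *-nonNeg : ∀ {x y} → 0ℚ ≤ x → 0ℚ ≤ y → 0ℚ ≤ x * y
  *-nonNeg {x} {y} 0≤x 0≤y =
    nonNegative⁻¹ (x * y) {{nonNeg*nonNeg⇒nonNeg x {{nonNegative 0≤x}} y {{nonNegative 0≤y}}}}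

  square-mono : ∀ {x y} → 0ℚ ≤ x → x ≤ y → x * x ≤ y * y
  square-mono {x} {y} 0≤x x≤y = ≤-trans (*-monoʳ-≤-nonNeg x {{nonNegative 0≤x}} x≤y)
                                        (*-monoˡ-≤-nonNeg y {{nonNegative (≤-trans 0≤x x≤y)}} x≤y)

  iterate-square-bound : ∀ (f : ℕ → ℚ) → (∀ s → 0ℚ ≤ f s) →
    (∀ s → 0 ℕ.< s → f (s ℕ.+ s) ≤ f s * f s) → ∀ k r → 0 ℕ.< r → f (2 ^ k ℕ.* r) ≤ f r ^ℚ (2 ^ k)
  iterate-square-bound f nonNeg square zero    r 0<r rewrite ℕ.+-identityʳ r =
    ≤-reflexive (sym (*-identityʳ (f r)))
  iterate-square-bound f nonNeg square (suc k) r 0<r = begin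
    f (2 ^ suc k ℕ.* r)                    ≡⟨ cong f (twice (2 ^ k) r) ⟩
    f (s ℕ.+ s)                            ≤⟨ square s 0<s ⟩
    f s * f s                              ≤⟨ square-mono (nonNeg s) (iterate-square-bound f nonNeg square k r 0<r) ⟩
    f r ^ℚ (2 ^ k) * f r ^ℚ (2 ^ k)        ≡⟨ ^ℚ-+ (f r) (2 ^ k) (2 ^ k) ⟨
    f r ^ℚ (2 ^ k ℕ.+ 2 ^ k)               ≡⟨ cong (f r ^ℚ_) (doubled (2 ^ k)) ⟨
    f r ^ℚ (2 ^ suc k)                     ∎
    where
    open ≤-Reasoning
    s : ℕ
    s = 2 ^ k ℕ.* r
    0<s : 0 ℕ.< s
    0<s = ℕ.>-nonZero⁻¹ s {{ℕ.m*n≢0 (2 ^ k) r {{ℕ.m^n≢0 2 k}} {{ℕ.>-nonZero 0<r}}}}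
    twice : ∀ p r → 2 ℕ.* p ℕ.* r ≡ p ℕ.* r ℕ.+ p ℕ.* r
    twice = solve-∀
    doubled : ∀ p → 2 ℕ.* p ≡ p ℕ.+ p
    doubled = solve-∀

  scaled : ℕ → ℕ → ℚ
  scaled m x = (+ m / suc m) * (+ x / 1)

  scaled-nonNeg : ∀ m x → 0ℚ ≤ scaled m x
  scaled-nonNeg m x = *-nonNeg (nonNegative⁻¹ (+ m / suc m) {{normalize-nonNeg m (suc m)}})
                               (nonNegative⁻¹ (+ x / 1) {{normalize-nonNeg x 1}})

  scaledᵘ : ℕ → ℕ → ℚᵘ.ℚᵘ
  scaledᵘ m x = ℚᵘ.mkℚᵘ (+ m) m ℚᵘ.* ℚᵘ.mkℚᵘ (+ x) 0

  toℚᵘ-scaled : ∀ m x → toℚᵘ (scaled m x) ℚᵘ.≃ scaledᵘ m x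
  toℚᵘ-scaled m x = ℚᵘ.≃-trans (toℚᵘ-homo-* (+ m / suc m) (+ x / 1))
                               (ℚᵘ.*-cong (toℚᵘ-fromℚᵘ (ℚᵘ.mkℚᵘ (+ m) m)) (toℚᵘ-fromℚᵘ (ℚᵘ.mkℚᵘ (+ x) 0)))

  -- (suc m * 1) is the denominator that ℚᵘ computes for (m / suc m) * (x / 1).
  cleared-square-bound : ∀ {m x y} → suc m ℕ.* x ℕ.≤ m ℕ.* (y ℕ.* y) →
    m ℕ.* x ℕ.* (suc m ℕ.* 1 ℕ.* (suc m ℕ.* 1)) ℕ.≤ m ℕ.* y ℕ.* (m ℕ.* y) ℕ.* (suc m ℕ.* 1)
  cleared-square-bound {m} {x} {y} h =
    subst (λ k → m ℕ.* x ℕ.* (k ℕ.* k) ℕ.≤ m ℕ.* y ℕ.* (m ℕ.* y) ℕ.* k) (sym (ℕ.*-identityʳ (suc m))) (begin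
      m ℕ.* x ℕ.* (suc m ℕ.* suc m)        ≡⟨ pull m x (suc m) ⟩
      m ℕ.* suc m ℕ.* (suc m ℕ.* x)        ≤⟨ ℕ.*-monoʳ-≤ (m ℕ.* suc m) h ⟩
      m ℕ.* suc m ℕ.* (m ℕ.* (y ℕ.* y))    ≡⟨ push m y (suc m) ⟩
      m ℕ.* y ℕ.* (m ℕ.* y) ℕ.* suc m      ∎)
    where
    open ℕ.≤-Reasoning
    pull : ∀ m x k → m ℕ.* x ℕ.* (k ℕ.* k) ≡ m ℕ.* k ℕ.* (k ℕ.* x)
    pull = solve-∀
    push : ∀ m y k → m ℕ.* k ℕ.* (m ℕ.* (y ℕ.* y)) ≡ m ℕ.* y ℕ.* (m ℕ.* y) ℕ.* k
    push = solve-∀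

  scaledᵘ-square : ∀ {m x y} → suc m ℕ.* x ℕ.≤ m ℕ.* (y ℕ.* y) → scaledᵘ m x ℚᵘ.≤ scaledᵘ m y ℚᵘ.* scaledᵘ m y
  scaledᵘ-square {m} {x} {y} h = ℚᵘ.*≤* (begin
    + m ℤ.* + x ℤ.* + (K ℕ.* K)              ≡⟨ cong (ℤ._* + (K ℕ.* K)) (pos-* m x) ⟨
    + (m ℕ.* x) ℤ.* + (K ℕ.* K)              ≡⟨ pos-* (m ℕ.* x) (K ℕ.* K) ⟨
    + (m ℕ.* x ℕ.* (K ℕ.* K))                ≤⟨ +≤+ (cleared-square-bound {m} {x} {y} h) ⟩
    + (m ℕ.* y ℕ.* (m ℕ.* y) ℕ.* K)          ≡⟨ pos-* (m ℕ.* y ℕ.* (m ℕ.* y)) K ⟩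
    + (m ℕ.* y ℕ.* (m ℕ.* y)) ℤ.* + K        ≡⟨ cong (ℤ._* + K) (pos-* (m ℕ.* y) (m ℕ.* y)) ⟩
    + (m ℕ.* y) ℤ.* + (m ℕ.* y) ℤ.* + K      ≡⟨ cong (λ z → z ℤ.* z ℤ.* + K) (pos-* m y) ⟩
    + m ℤ.* + y ℤ.* (+ m ℤ.* + y) ℤ.* + K    ∎)
    where
    open ℤ.≤-Reasoning
    K : ℕ
    K = suc m ℕ.* 1

  scaled-square : ∀ m x y → suc m ℕ.* x ℕ.≤ m ℕ.* (y ℕ.* y) → scaled m x ≤ scaled m y * scaled m y
  scaled-square m x y h = toℚᵘ-cancel-≤ (begin
    toℚᵘ (scaled m x)                          ≃⟨ toℚᵘ-scaled m x ⟩
    scaledᵘ m x                                ≤⟨ scaledᵘ-square {m} {x} {y} h ⟩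
    scaledᵘ m y ℚᵘ.* scaledᵘ m y               ≃⟨ ℚᵘ.*-cong (toℚᵘ-scaled m y) (toℚᵘ-scaled m y) ⟨
    toℚᵘ (scaled m y) ℚᵘ.* toℚᵘ (scaled m y)   ≃⟨ toℚᵘ-homo-* (scaled m y) (scaled m y) ⟨
    toℚᵘ (scaled m y * scaled m y)             ∎)
    where open ℚᵘ.≤-Reasoning

open import Data.Nat using (suc; _^_)
open import Data.Integer using (+_)
open import Data.Rational using (_/_; _≤_) renaming (_*_ to _*ℚ_)
open import Defs using (IsCliqueNumber; w; _^ℚ_)
open MotzkinStraus using (walks-doubling-bound)
open Squaring using (scaled; iterate-square-bound; scaled-nonNeg; scaled-square)

mainTheorem7 : ∀ (n : ℕ) (G : Graph (suc n)) (m : ℕ) → IsCliqueNumber G (suc m) →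
    ∀ (k r : ℕ) → 0 Data.Nat.< k → 0 Data.Nat.< r →
    ((+ m) / suc m) *ℚ ((+ w (2 ^ k Data.Nat.* r) G) / 1)
    ≤ (((+ m) / suc m) *ℚ ((+ w r G) / 1)) ^ℚ (2 ^ k)
mainTheorem7 n G m ω k r _ 0<r =
  -- The bound also holds for k = 0.
  iterate-square-bound (λ s → scaled m (w s G)) (λ s → scaled-nonNeg m (w s G))
                       (λ s 0<s → scaled-square m _ (w s G) (walks-doubling-bound G ω s 0<s)) k r 0<r
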